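{- Let $P$ be a finite poset, $r\ge1$ an integer, $(n,\chi)\in\mathcal{C}(P)$, and let $s$ be the maximum size of a $\chi$-homogeneous subset of $[n]$. Let $A\subseteq[n]$ be a $\chi$-homogeneous set with $|A|=s-(4r-4)$ and $B\subseteq[n]$ a $\chi$-homogeneous set with $A<B$ (every element of $A$ is smaller than every element of $B$), and suppose $|A|\ge 2r$ and $|B|\ge 6r$. Then $(n,\chi)$ contains an $r$-rich coloring, i.e. there is an $r$-rich coloring $K$ with $K\preceq(n,\chi)$.
   Context: $\mathcal{C}(P)$ is the set of colorings $(n,\chi)$, $n\in\mathbb{N}_0$, $\chi:\binom{[n]}{2}\to P$; $(m,\psi)\preceq(n,\chi)$ iff some increasing $f:[m]\to[n]$ has $\psi(\{i,j\})\le_P\chi(\{f(i),f(j)\})$ for all $i<j$. $A\subseteq[n]$ is $\chi$-homogeneous if $\chi$ is constant on $\binom{A}{2}$. The reversal of $(n,\chi)$ is $(n,\psi)$ with $\psi(\{i,j\})=\chi(\{n-i+1,n-j+1\})$. A coloring $(m,\chi)$ is $r$-rich if $m=2r-1$ and either (type 1) in it or its reversal $\chi(\{i,i+1\})=a$ for $1\le i\le r-1$ and $\chi(\{r,r+1\})=b$ with $a\ne b$; or (type 2) in it or its reversal $\chi(\{1,i\})=a$ for $2\le i\le r$ and $\chi(\{1,r+1\})=b$ with $a\ne b$; other edges arbitrary. -}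

module Defs where

open import Level using (0ℓ)
open import Data.Nat using (ℕ; zero; suc; _+_; _*_; _∸_) renaming (_<_ to _<ℕ_; _≤_ to _≤ℕ_)
open import Data.Fin using (Fin; toℕ; opposite; _<_)
open import Data.Fin.Subset using (Subset; _∈_; ∣_∣)
open import Data.Product using (Σ; ∃; _×_; _,_)
open import Data.Sum using (_⊎_)
open import Relation.Binary using (Rel)
open import Relation.Binary.PropositionalEquality using (_≡_; _≢_)

-- A finite poset P is represented (up to isomorphism) by the carrier Fin k
-- together with a partial order _≤P_ on it (w.r.t. propositional equality).

-- Vertices [n] are Fin n (0-based: vertex v is
-- the paper's v+1).  The colour of the edge {i,j} with i < j is  χ i j ;
-- values  χ i j  with i ≥ j are never used by any definition below.
record Col (k : ℕ) : Set where
  constructor col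
  field
    n : ℕ
    χ : Fin n → Fin n → Fin k

open Col public

_≼[_]_ : {k : ℕ} → Col k → Rel (Fin k) 0ℓ → Col k → Set
K ≼[ _≤P_ ] L =
  Σ (Fin (n K) → Fin (n L)) λ f →
    (∀ i j → i < j → f i < f j) ×
    (∀ i j → i < j → χ K i j ≤P χ L (f i) (f j))

-- Reversal: ψ({i,j}) = χ({n-i+1, n-j+1}); for i < j the pair
-- {opposite j , opposite i} has opposite j < opposite i.
reversal : {k : ℕ} → Col k → Col k
reversal (col n χ) = col n (λ i j → χ (opposite j) (opposite i))

Homogeneous : {k n : ℕ} → (Fin n → Fin n → Fin k) → Subset n → Set
Homogeneous χ A =
  ∀ i j i' j' → i ∈ A → j ∈ A → i < j → i' ∈ A → j' ∈ A → i' < j' →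
    χ i j ≡ χ i' j'

IsMaxHomSize : {k n : ℕ} → (Fin n → Fin n → Fin k) → ℕ → Set
IsMaxHomSize {n = n} χ s =
  (Σ (Subset n) λ A → Homogeneous χ A × ∣ A ∣ ≡ s) ×
  (∀ (A : Subset n) → Homogeneous χ A → ∣ A ∣ ≤ℕ s)

_<ˢ_ : {n : ℕ} → Subset n → Subset n → Set
A <ˢ B = ∀ i j → i ∈ A → j ∈ B → i < j

-- Type 1 (paper, 1-based): χ({i,i+1}) = a for 1 ≤ i ≤ r-1, χ({r,r+1}) = b.
-- Here i is 0-based, paper index I = suc (toℕ i).
RichType1 : {k m : ℕ} → ℕ → Fin k → Fin k → (Fin m → Fin m → Fin k) → Set
RichType1 r a b χ =
  (∀ i j → toℕ j ≡ suc (toℕ i) → suc (toℕ i) <ℕ r → χ i j ≡ a) ×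
  (∀ i j → toℕ j ≡ suc (toℕ i) → suc (toℕ i) ≡ r → χ i j ≡ b)

-- Type 2 (paper, 1-based): χ({1,i}) = a for 2 ≤ i ≤ r, χ({1,r+1}) = b.
RichType2 : {k m : ℕ} → ℕ → Fin k → Fin k → (Fin m → Fin m → Fin k) → Set
RichType2 r a b χ =
  (∀ i j → toℕ i ≡ 0 → 1 ≤ℕ toℕ j → suc (toℕ j) ≤ℕ r → χ i j ≡ a) ×
  (∀ i j → toℕ i ≡ 0 → toℕ j ≡ r → χ i j ≡ b)

Rich : {k : ℕ} → ℕ → Col k → Set
Rich r K =
  n K ≡ 2 * r ∸ 1 ×
  ∃ λ a → ∃ λ b → a ≢ b ×
    (RichType1 r a b (χ K) ⊎ RichType1 r a b (χ (reversal K)) ⊎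
     RichType2 r a b (χ K) ⊎ RichType2 r a b (χ (reversal K)))

-- Write r = q + 1, let α and β be the colours of A and B, and let A' (B') be A (B)
-- without its first (last) q elements. Suppose some edge {x, y} with x ∈ A', y ∈ B'
-- has a colour c with c ≠ α or c ≠ β. The r points of A up to x followed by the r
-- points of B from y form a path of 2r points whose consecutive edges read
-- α…α c β…β; its first 2r - 1 points (if c ≠ α), or its last 2r - 1 points read
-- backwards (if c ≠ β), are an r-rich coloring of type 1. Otherwise α = β and
-- A' ∪ B' is homogeneous of size at least |A| + |B| - 2q ≥ |A| + 4r + 2 > s.
module Submission where

open import Defs hiding (n; χ)
open import Level using (0ℓ)
open import Data.Nat using (ℕ; zero; suc; _+_; _*_; _∸_; _≤_; _<_; z≤n; s≤s; _≤?_; _<?_)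
open import Data.Nat.Properties hiding (_≟_)
open import Data.Nat.Tactic.RingSolver using (solve-∀)
open import Algebra.Properties.CommutativeSemigroup +-commutativeSemigroup using (interchange)
open import Data.Fin as Fin using (Fin; zero; suc; toℕ; opposite; _≟_)
open import Data.Fin.Properties using (opposite-prop; toℕ<n; any?)
open import Data.Fin.Subset using (Subset; inside; outside; _∈_; _⊆_; _∪_; _∩_; ∣_∣; Nonempty; Empty)
open import Data.Fin.Subset.Properties using (_∈?_; x∈p∪q⁻; x∈p∩q⁻; drop-∷-Empty)
open import Data.Vec.Base using ([]; _∷_; here; there)
open import Data.Product using (Σ; ∃; ∃₂; _×_; _,_; proj₁; proj₂)
import Data.Product as Product
open import Data.Sum using (_⊎_; inj₁; inj₂)
open import Function using (_∘_)
open import Relation.Binary using (Rel; Reflexive; IsPartialOrder)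
open import Relation.Binary.PropositionalEquality
open import Relation.Nullary using (Dec; yes; no; ¬_; contradiction)
open import Relation.Nullary.Decidable using (_×-dec_; ¬?; decidable-stable)

private variable
  n m k p q : ℕ
  S T : Subset n
  x y : Fin n

-- Sequences are indexed by ℕ rather than Fin m so that they can be joined and
-- shifted without casts; only the values below the length matter.
IncreasingBelow : ℕ → (ℕ → Fin n) → Set
IncreasingBelow m h = ∀ {i j} → i < j → j < m → h i Fin.< h j

increasingBelow-≤ : {h : ℕ → Fin n} → m ≤ p → IncreasingBelow p h → IncreasingBelow m h
increasingBelow-≤ m≤p inc i<j j<m = inc i<j (<-≤-trans j<m m≤p)

increasingBelow-suc : {h : ℕ → Fin n} → IncreasingBelow (suc m) h → IncreasingBelow m (h ∘ suc)
increasingBelow-suc inc i<j j<m = inc (s≤s i<j) (s≤s j<m)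

record Chain (S : Subset n) (m : ℕ) : Set where
  field
    at : ℕ → Fin n
    increasing : IncreasingBelow m at
    within : ∀ {i} → i < m → at i ∈ S

open Chain

singleton : x ∈ S → Chain S 1
singleton {x = x} x∈S .at _ = x
singleton x∈S .increasing {j = zero} ()
singleton x∈S .increasing {j = suc _} _ (s≤s ())
singleton x∈S .within _ = x∈S

skip : ∀ {b} → Chain S m → Chain (b ∷ S) m
skip c .at = suc ∘ at c
skip c .increasing i<j j<m = s≤s (increasing c i<j j<m)
skip c .within i<m = there (within c i<m)

cons : Chain S m → Chain (inside ∷ S) (suc m)
cons c .at zero = zero
cons c .at (suc i) = suc (at c i)
cons c .increasing {j = zero} ()
cons c .increasing {zero} {suc j} _ _ = s≤s z≤n
cons c .increasing {suc i} {suc j} (s≤s i<j) (s≤s j<m) = s≤s (increasing c i<j j<m)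
cons c .within {zero} _ = here
cons c .within {suc i} (s≤s i<m) = there (within c i<m)

chain-of-length : suc m ≤ ∣ S ∣ → Chain S (suc m)
chain-of-length {S = outside ∷ S} m<∣S∣ = skip (chain-of-length m<∣S∣)
chain-of-length {m = zero} {S = inside ∷ S} _ = singleton here
chain-of-length {m = suc m} {S = inside ∷ S} (s≤s m<∣S∣) = cons (chain-of-length m<∣S∣)

nonempty : 0 < ∣ S ∣ → Nonempty S
nonempty 0<∣S∣ = at c 0 , within c (s≤s z≤n)
  where c = chain-of-length 0<∣S∣

join : (ℕ → Fin n) → ℕ → (ℕ → Fin n) → ℕ → Fin n
join e p e′ i with i <? p
... | yes _ = e i
... | no _ = e′ (i ∸ p)

join-left : ∀ {e e′ : ℕ → Fin n} {i} → i < p → join e p e′ i ≡ e i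
join-left {p = p} {i = i} i<p with i <? p
... | yes _ = refl
... | no i≮p = contradiction i<p i≮p

join-right : ∀ {e e′ : ℕ → Fin n} {i} → p ≤ i → join e p e′ i ≡ e′ (i ∸ p)
join-right {p = p} {i = i} p≤i with i <? p
... | yes i<p = contradiction i<p (≤⇒≯ p≤i)
... | no _ = refl

∸-<-bound : ∀ {i} → p ≤ i → i < p + q → i ∸ p < q
∸-<-bound {p = p} {q} p≤i i<p+q = subst (_ <_) (m+n∸m≡n p q) (∸-monoˡ-< i<p+q p≤i)

join-increasing : S <ˢ T → (c : Chain S p) (d : Chain T q) →
  IncreasingBelow (p + q) (join (at c) p (at d))
join-increasing {p = p} S<T c d {i} {j} i<j j<p+q with i <? p | j <? p
... | yes i<p | yes j<p = increasing c i<j j<p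
... | yes i<p | no j≮p = S<T _ _ (within c i<p) (within d (∸-<-bound (≮⇒≥ j≮p) j<p+q))
... | no i≮p | yes j<p = contradiction (<-trans i<j j<p) i≮p
... | no i≮p | no j≮p =
  increasing d (∸-monoˡ-< i<j (≮⇒≥ i≮p)) (∸-<-bound (≮⇒≥ j≮p) j<p+q)

join-∈-left : ∀ {e : ℕ → Fin n} (c : Chain S p) {i} → i < p → join (at c) p e i ∈ S
join-∈-left {S = S} c i<p = subst (_∈ S) (sym (join-left i<p)) (within c i<p)

join-∈-right : ∀ {e : ℕ → Fin n} (d : Chain T q) {i} → p ≤ i → i < p + q →
  join e p (at d) i ∈ T
join-∈-right {T = T} d p≤i i<p+q =
  subst (_∈ T) (sym (join-right p≤i)) (within d (∸-<-bound p≤i i<p+q))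

dropFirst : ℕ → Subset n → Subset n
dropFirst zero S = S
dropFirst (suc k) [] = []
dropFirst (suc k) (outside ∷ S) = outside ∷ dropFirst (suc k) S
dropFirst (suc k) (inside ∷ S) = outside ∷ dropFirst k S

dropLast : ℕ → Subset n → Subset n
dropLast k [] = []
dropLast k (outside ∷ S) = outside ∷ dropLast k S
dropLast k (inside ∷ S) with k ≤? ∣ S ∣
... | yes _ = inside ∷ dropLast k S
... | no _ = outside ∷ dropLast k S

dropFirst⇒chain : ∀ k → x ∈ dropFirst k S → Σ (Chain S (suc k)) λ c → at c k ≡ x
dropFirst⇒chain zero x∈S = singleton x∈S , refl
dropFirst⇒chain {S = outside ∷ S} (suc k) (there x∈) =
  Product.map skip (cong suc) (dropFirst⇒chain (suc k) x∈)
dropFirst⇒chain {S = inside ∷ S} (suc k) (there x∈) =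
  Product.map cons (cong suc) (dropFirst⇒chain k x∈)

dropLast⇒chain : ∀ k → y ∈ dropLast k S → Σ (Chain S (suc k)) λ c → at c 0 ≡ y
dropLast⇒chain {S = outside ∷ S} k (there y∈) =
  Product.map skip (cong suc) (dropLast⇒chain k y∈)
dropLast⇒chain {S = inside ∷ S} k y∈ with k ≤? ∣ S ∣
dropLast⇒chain {S = inside ∷ S} zero here | yes _ = singleton here , refl
dropLast⇒chain {S = inside ∷ S} (suc k) here | yes k<∣S∣ = cons (chain-of-length k<∣S∣) , refl
dropLast⇒chain {S = inside ∷ S} k (there y∈) | yes _ =
  Product.map skip (cong suc) (dropLast⇒chain k y∈)
dropLast⇒chain {S = inside ∷ S} k (there y∈) | no _ =
  Product.map skip (cong suc) (dropLast⇒chain k y∈)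

dropFirst-⊆ : dropFirst k S ⊆ S
dropFirst-⊆ {k = k} {S = S} x∈ =
  let c , last≡x = dropFirst⇒chain k x∈ in subst (_∈ S) last≡x (within c (n<1+n k))

dropLast-⊆ : dropLast k S ⊆ S
dropLast-⊆ {k = k} {S = S} y∈ =
  let c , first≡y = dropLast⇒chain k y∈ in subst (_∈ S) first≡y (within c (s≤s z≤n))

∣S∣≤k+∣dropFirst∣ : ∀ k (S : Subset n) → ∣ S ∣ ≤ k + ∣ dropFirst k S ∣
∣S∣≤k+∣dropFirst∣ zero S = ≤-refl
∣S∣≤k+∣dropFirst∣ (suc k) [] = z≤n
∣S∣≤k+∣dropFirst∣ (suc k) (outside ∷ S) = ∣S∣≤k+∣dropFirst∣ (suc k) S
∣S∣≤k+∣dropFirst∣ (suc k) (inside ∷ S) = s≤s (∣S∣≤k+∣dropFirst∣ k S)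

∣S∣≤k+∣dropLast∣ : ∀ k (S : Subset n) → ∣ S ∣ ≤ k + ∣ dropLast k S ∣
∣S∣≤k+∣dropLast∣ k [] = z≤n
∣S∣≤k+∣dropLast∣ k (outside ∷ S) = ∣S∣≤k+∣dropLast∣ k S
∣S∣≤k+∣dropLast∣ k (inside ∷ S) with k ≤? ∣ S ∣
... | yes _ = ≤-trans (s≤s (∣S∣≤k+∣dropLast∣ k S)) (≤-reflexive (sym (+-suc k _)))
... | no k≰∣S∣ = ≤-trans (≰⇒> k≰∣S∣) (m≤m+n k _)

∣S∣+∣T∣≤∣S∪T∣ : ∀ (S T : Subset n) → Empty (S ∩ T) → ∣ S ∣ + ∣ T ∣ ≤ ∣ S ∪ T ∣
∣S∣+∣T∣≤∣S∪T∣ [] [] _ = z≤n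
∣S∣+∣T∣≤∣S∪T∣ (inside ∷ S) (inside ∷ T) disjoint = contradiction (zero , here) disjoint
∣S∣+∣T∣≤∣S∪T∣ (inside ∷ S) (outside ∷ T) disjoint =
  s≤s (∣S∣+∣T∣≤∣S∪T∣ S T (drop-∷-Empty disjoint))
∣S∣+∣T∣≤∣S∪T∣ (outside ∷ S) (inside ∷ T) disjoint =
  ≤-trans (≤-reflexive (+-suc ∣ S ∣ ∣ T ∣)) (s≤s (∣S∣+∣T∣≤∣S∪T∣ S T (drop-∷-Empty disjoint)))
∣S∣+∣T∣≤∣S∪T∣ (outside ∷ S) (outside ∷ T) disjoint =
  ∣S∣+∣T∣≤∣S∪T∣ S T (drop-∷-Empty disjoint)

counterexample⊎all : (S T : Subset n) (P : Fin n → Fin n → Set) → (∀ x y → Dec (P x y)) →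
  (∃₂ λ x y → x ∈ S × y ∈ T × ¬ P x y) ⊎ (∀ {x y} → x ∈ S → y ∈ T → P x y)
counterexample⊎all S T P P? with any? (λ x → any? (λ y → x ∈? S ×-dec y ∈? T ×-dec ¬? (P? x y)))
... | yes (x , y , counterexample) = inj₁ (x , y , counterexample)
... | no ∄ = inj₂ λ {x} {y} x∈S y∈T →
  decidable-stable (P? x y) λ ¬P → ∄ (x , y , x∈S , y∈T , ¬P)

opposite-sum : ∀ (i : Fin m) → toℕ (opposite i) + suc (toℕ i) ≡ m
opposite-sum i = trans (cong (_+ suc (toℕ i)) (opposite-prop i)) (m∸n+n≡m (toℕ<n i))

opposite-pred : ∀ {i j : Fin m} → toℕ j ≡ suc (toℕ i) → toℕ (opposite i) ≡ suc (toℕ (opposite j))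
opposite-pred {i = i} {j} j≡1+i = +-cancelʳ-≡ (suc (toℕ i)) _ _ (begin
  toℕ (opposite i) + suc (toℕ i)        ≡⟨ opposite-sum i ⟩
  _                                     ≡⟨ sym (opposite-sum j) ⟩
  toℕ (opposite j) + suc (toℕ j)        ≡⟨ cong (λ t → toℕ (opposite j) + suc t) j≡1+i ⟩
  toℕ (opposite j) + suc (suc (toℕ i))  ≡⟨ +-suc (toℕ (opposite j)) (suc (toℕ i)) ⟩
  suc (toℕ (opposite j)) + suc (toℕ i)  ∎)
  where open ≡-Reasoning

2[1+q]∸1≡q+[1+q] : ∀ q → 2 * suc q ∸ 1 ≡ q + suc q
2[1+q]∸1≡q+[1+q] q = cong (q +_) (+-identityʳ (suc q))

module _ {n k : ℕ} (χ : Fin n → Fin n → Fin k) where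

  Monochromatic : Fin k → Subset n → Set
  Monochromatic c S = ∀ {x y} → x ∈ S → y ∈ S → x Fin.< y → χ x y ≡ c

  homogeneous⇒monochromatic : {S : Subset n} → Homogeneous χ S → 2 ≤ ∣ S ∣ →
    ∃ λ c → Monochromatic c S
  homogeneous⇒monochromatic hom 2≤∣S∣ =
    χ (at c 0) (at c 1) ,
    λ x∈ y∈ x<y →
      hom _ _ _ _ x∈ y∈ x<y (within c (s≤s z≤n)) (within c ≤-refl) (increasing c ≤-refl ≤-refl)
    where c = chain-of-length 2≤∣S∣

  monochromatic⇒homogeneous : ∀ {c} {S : Subset n} → Monochromatic c S → Homogeneous χ S
  monochromatic⇒homogeneous mono _ _ _ _ i∈ j∈ i<j i′∈ j′∈ i′<j′ =
    trans (mono i∈ j∈ i<j) (sym (mono i′∈ j′∈ i′<j′))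

  monochromatic-⊆ : ∀ {c} {S T : Subset n} → S ⊆ T → Monochromatic c T → Monochromatic c S
  monochromatic-⊆ S⊆T mono x∈ y∈ = mono (S⊆T x∈) (S⊆T y∈)

  monochromatic-∪ : ∀ {c} {S T : Subset n} → S <ˢ T → Monochromatic c S → Monochromatic c T →
    (∀ {x y} → x ∈ S → y ∈ T → χ x y ≡ c) → Monochromatic c (S ∪ T)
  monochromatic-∪ {S = S} {T} S<T S-c T-c crossing {x} {y} x∈ y∈ x<y
    with x∈p∪q⁻ S T x∈ | x∈p∪q⁻ S T y∈
  ... | inj₁ x∈S | inj₁ y∈S = S-c x∈S y∈S x<y
  ... | inj₁ x∈S | inj₂ y∈T = crossing x∈S y∈T
  ... | inj₂ x∈T | inj₁ y∈S = contradiction (S<T _ _ y∈S x∈T) (<-asym x<y)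
  ... | inj₂ x∈T | inj₂ y∈T = T-c x∈T y∈T x<y

  stepColour : (ℕ → Fin n) → ℕ → Fin k
  stepColour h i = χ (h i) (h (suc i))

  induced : (ℕ → Fin n) → ℕ → Col k
  induced h m = col m λ i j → χ (h (toℕ i)) (h (toℕ j))

  induced-richType1 : ∀ {q m a b h} →
    (∀ {i} → i < q → stepColour h i ≡ a) → stepColour h q ≡ b →
    RichType1 (suc q) a b (Col.χ (induced h m))
  induced-richType1 {h = h} prefix middle =
    (λ i j j≡1+i 1+i<r → trans (edge j≡1+i) (prefix (≤-pred 1+i<r))) ,
    (λ i j j≡1+i 1+i≡r →
      trans (edge j≡1+i) (trans (cong (stepColour h) (suc-injective 1+i≡r)) middle))
    where
    edge : ∀ {i j : ℕ} → j ≡ suc i → χ (h i) (h j) ≡ stepColour h i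
    edge = cong (χ _ ∘ h)

  reversal-induced-richType1 : ∀ {q a b h} →
    (∀ {i} → q < i → i < 2 * suc q ∸ 1 → stepColour h i ≡ a) → stepColour h q ≡ b →
    RichType1 (suc q) a b (Col.χ (reversal (induced (h ∘ suc) (2 * suc q ∸ 1))))
  reversal-induced-richType1 {q} {h = h} suffix middle =
    (λ i j j≡1+i 1+i<r → trans (edge j≡1+i) (suffix (q<ŏ (≤-pred 1+i<r)) (toℕ<n (opposite i)))) ,
    (λ i j j≡1+i 1+i≡r →
      trans (edge j≡1+i) (trans (cong (stepColour h) (ŏ≡q (suc-injective 1+i≡r))) middle))
    where
    edge : ∀ {i j : Fin (2 * suc q ∸ 1)} → toℕ j ≡ suc (toℕ i) →
      χ (h (suc (toℕ (opposite j)))) (h (suc (toℕ (opposite i)))) ≡ stepColour h (toℕ (opposite i))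
    edge {i} j≡1+i = cong (λ t → χ (h t) (h (suc (toℕ (opposite i))))) (sym (opposite-pred j≡1+i))

    ŏ+1+i≡q+1+q : ∀ (i : Fin (2 * suc q ∸ 1)) → toℕ (opposite i) + suc (toℕ i) ≡ q + suc q
    ŏ+1+i≡q+1+q i = trans (opposite-sum i) (2[1+q]∸1≡q+[1+q] q)

    q<ŏ : ∀ {i : Fin (2 * suc q ∸ 1)} → toℕ i < q → q < toℕ (opposite i)
    q<ŏ {i} i<q = +-cancelˡ-≤ q (suc q) _ (begin
      q + suc q                       ≡⟨ sym (ŏ+1+i≡q+1+q i) ⟩
      toℕ (opposite i) + suc (toℕ i)  ≤⟨ +-monoʳ-≤ (toℕ (opposite i)) i<q ⟩
      toℕ (opposite i) + q            ≡⟨ +-comm (toℕ (opposite i)) q ⟩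
      q + toℕ (opposite i)            ∎)
      where open ≤-Reasoning

    ŏ≡q : ∀ {i : Fin (2 * suc q ∸ 1)} → toℕ i ≡ q → toℕ (opposite i) ≡ q
    ŏ≡q {i} i≡q = +-cancelʳ-≡ (suc q) _ _
      (trans (cong (λ t → toℕ (opposite i) + suc t) (sym i≡q)) (ŏ+1+i≡q+1+q i))

  large-homogeneous-union : ∀ {q α β} {A B : Subset n} →
    A <ˢ B → Monochromatic α A → Monochromatic β B → q < ∣ A ∣ → q < ∣ B ∣ →
    (∀ {x y} → x ∈ dropFirst q A → y ∈ dropLast q B → χ x y ≡ α × χ x y ≡ β) →
    ∃ λ U → Homogeneous χ U × ∣ A ∣ + ∣ B ∣ ≤ (q + q) + ∣ U ∣
  large-homogeneous-union {q} {α} {β} {A} {B} A<B A-α B-β q<∣A∣ q<∣B∣ uniform =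
    A′ ∪ B′ ,
    monochromatic⇒homogeneous (monochromatic-∪ A′<B′ A′-α B′-α (λ x∈ y∈ → proj₁ (uniform x∈ y∈))) ,
    size
    where
    A′ = dropFirst q A
    B′ = dropLast q B

    A′<B′ : A′ <ˢ B′
    A′<B′ x y x∈ y∈ = A<B x y (dropFirst-⊆ x∈) (dropLast-⊆ y∈)

    positive : ∀ {a b} → q < a → a ≤ q + b → 0 < b
    positive {a} {b} q<a a≤q+b =
      +-cancelˡ-< q 0 b (subst (_< q + b) (sym (+-identityʳ q)) (<-≤-trans q<a a≤q+b))

    β≡α : β ≡ α
    β≡α with nonempty (positive q<∣A∣ (∣S∣≤k+∣dropFirst∣ q A))
           | nonempty (positive q<∣B∣ (∣S∣≤k+∣dropLast∣ q B))
    ... | _ , x∈ | _ , y∈ = trans (sym (proj₂ (uniform x∈ y∈))) (proj₁ (uniform x∈ y∈))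

    A′-α : Monochromatic α A′
    A′-α = monochromatic-⊆ dropFirst-⊆ A-α

    B′-α : Monochromatic α B′
    B′-α = subst (λ c → Monochromatic c B′) β≡α (monochromatic-⊆ dropLast-⊆ B-β)

    size : ∣ A ∣ + ∣ B ∣ ≤ (q + q) + ∣ A′ ∪ B′ ∣
    size = begin
      ∣ A ∣ + ∣ B ∣                ≤⟨ +-mono-≤ (∣S∣≤k+∣dropFirst∣ q A) (∣S∣≤k+∣dropLast∣ q B) ⟩
      (q + ∣ A′ ∣) + (q + ∣ B′ ∣)  ≡⟨ interchange q (∣ A′ ∣) q (∣ B′ ∣) ⟩
      (q + q) + (∣ A′ ∣ + ∣ B′ ∣)  ≤⟨ +-monoʳ-≤ (q + q) (∣S∣+∣T∣≤∣S∪T∣ A′ B′ disjoint) ⟩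
      (q + q) + ∣ A′ ∪ B′ ∣        ∎
      where
      open ≤-Reasoning
      disjoint : Empty (A′ ∩ B′)
      disjoint (x , x∈A′∩B′) =
        let x∈A′ , x∈B′ = x∈p∩q⁻ A′ B′ x∈A′∩B′ in <-irrefl refl (A′<B′ x x x∈A′ x∈B′)

  module _ {_≤P_ : Rel (Fin k) 0ℓ} (≤P-refl : Reflexive _≤P_) where

    induced-≼ : ∀ {h m} → IncreasingBelow m h →
      induced h m ≼[ _≤P_ ] col n χ
    induced-≼ {h = h} inc = h ∘ toℕ , (λ i j i<j → inc i<j (toℕ<n j)) , λ _ _ _ → ≤P-refl

    rich-of-mixed-path : ∀ {q α β h} →
      IncreasingBelow (suc (2 * suc q ∸ 1)) h →
      (∀ {i} → i < q → stepColour h i ≡ α) →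
      (∀ {i} → q < i → i < 2 * suc q ∸ 1 → stepColour h i ≡ β) →
      ¬ (stepColour h q ≡ α × stepColour h q ≡ β) →
      Σ (Col k) λ K → Rich (suc q) K × K ≼[ _≤P_ ] col n χ
    rich-of-mixed-path {q = q} {α} {β} {h} inc prefix suffix mixed with stepColour h q ≟ α
    ... | no c≢α =
      induced h (2 * suc q ∸ 1) ,
      (refl , α , stepColour h q , c≢α ∘ sym ,
        inj₁ (induced-richType1 {m = 2 * suc q ∸ 1} prefix refl)) ,
      induced-≼ (increasingBelow-≤ (n≤1+n _) inc)
    ... | yes c≡α =
      induced (h ∘ suc) (2 * suc q ∸ 1) ,
      (refl , β , stepColour h q , (λ β≡c → mixed (c≡α , sym β≡c)) ,
        inj₂ (inj₁ (reversal-induced-richType1 {h = h} suffix refl))) ,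
      induced-≼ (increasingBelow-suc inc)

    rich-of-crossing : ∀ {q α β} {A B : Subset n} {x y} →
      A <ˢ B → Monochromatic α A → Monochromatic β B →
      Σ (Chain A (suc q)) (λ c → at c q ≡ x) → Σ (Chain B (suc q)) (λ d → at d 0 ≡ y) →
      ¬ (χ x y ≡ α × χ x y ≡ β) →
      Σ (Col k) λ K → Rich (suc q) K × K ≼[ _≤P_ ] col n χ
    rich-of-crossing {q = q} {α} {β} A<B A-α B-β (c , refl) (d , refl) mixed =
      rich-of-mixed-path path-increasing prefix suffix
        (mixed ∘ subst (λ c → c ≡ α × c ≡ β) middle)
      where
      path : ℕ → Fin n
      path = join (at c) (suc q) (at d)

      length : suc (2 * suc q ∸ 1) ≡ suc q + suc q
      length = cong suc (2[1+q]∸1≡q+[1+q] q)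

      path-increasing : IncreasingBelow (suc (2 * suc q ∸ 1)) path
      path-increasing = subst (λ t → IncreasingBelow t path) (sym length) (join-increasing A<B c d)

      prefix : ∀ {i} → i < q → stepColour path i ≡ α
      prefix i<q = A-α (join-∈-left c (m<n⇒m<1+n i<q)) (join-∈-left c (s≤s i<q))
        (join-increasing A<B c d ≤-refl (s≤s (≤-trans i<q (m≤m+n q _))))

      suffix : ∀ {i} → q < i → i < 2 * suc q ∸ 1 → stepColour path i ≡ β
      suffix {i} q<i i<m = B-β (join-∈-right d q<i i<2r) (join-∈-right d (m<n⇒m<1+n q<i) 1+i<2r)
        (join-increasing A<B c d (n<1+n i) 1+i<2r)
        where
        1+i<2r : suc i < suc q + suc q
        1+i<2r = subst (suc i <_) length (s≤s i<m)
        i<2r : i < suc q + suc q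
        i<2r = <-trans (n<1+n i) 1+i<2r

      middle : stepColour path q ≡ χ (at c q) (at d 0)
      middle = cong₂ χ (join-left {e′ = at d} (n<1+n q))
        (trans (join-right {e = at c} (≤-refl {suc q})) (cong (at d) (n∸n≡0 (suc q))))

    rich⊎large-homogeneous : ∀ {q α β} {A B : Subset n} →
      A <ˢ B → Monochromatic α A → Monochromatic β B → q < ∣ A ∣ → q < ∣ B ∣ →
      (Σ (Col k) λ K → Rich (suc q) K × K ≼[ _≤P_ ] col n χ) ⊎
      (∃ λ U → Homogeneous χ U × ∣ A ∣ + ∣ B ∣ ≤ (q + q) + ∣ U ∣)
    rich⊎large-homogeneous {q = q} {α} {β} {A} {B} A<B A-α B-β q<∣A∣ q<∣B∣
      with counterexample⊎all (dropFirst q A) (dropLast q B) (λ x y → χ x y ≡ α × χ x y ≡ β)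
             (λ x y → (χ x y ≟ α) ×-dec (χ x y ≟ β))
    ... | inj₂ uniform = inj₂ (large-homogeneous-union A<B A-α B-β q<∣A∣ q<∣B∣ uniform)
    ... | inj₁ (_ , _ , x∈ , y∈ , mixed) =
      inj₁ (rich-of-crossing A<B A-α B-β (dropFirst⇒chain q x∈) (dropLast⇒chain q y∈) mixed)

cardinality-bound : ∀ {a b u} q → a + b ≤ (q + q) + u → u ≤ a + (4 * suc q ∸ 4) → b < 6 * suc q
cardinality-bound {a} {b} {u} q a+b≤ u≤ = +-cancelˡ-< a b (6 * suc q) (begin-strict
  a + b                                 ≤⟨ a+b≤ ⟩
  (q + q) + u                           ≤⟨ +-monoʳ-≤ (q + q) u≤ ⟩
  (q + q) + (a + (4 * suc q ∸ 4))       ≡⟨ cong (λ t → (q + q) + (a + (t ∸ 4))) (*-suc 4 q) ⟩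
  (q + q) + (a + 4 * q)                 ≡⟨ regroup a q ⟩
  a + 6 * q                             <⟨ +-monoʳ-< a (*-monoʳ-< 6 (n<1+n q)) ⟩
  a + 6 * suc q                         ∎)
  where
  open ≤-Reasoning
  regroup : ∀ a q → (q + q) + (a + 4 * q) ≡ a + 6 * q
  regroup = solve-∀

lemma3p6 : (k : ℕ) (_≤P_ : Rel (Fin k) 0ℓ) → IsPartialOrder _≡_ _≤P_ →
    (r : ℕ) → 1 ≤ r →
    (n : ℕ) (χ : Fin n → Fin n → Fin k) →
    (s : ℕ) → IsMaxHomSize χ s →
    (A B : Subset n) → Homogeneous χ A → Homogeneous χ B →
    ∣ A ∣ + (4 * r ∸ 4) ≡ s → A <ˢ B →
    2 * r ≤ ∣ A ∣ → 6 * r ≤ ∣ B ∣ →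
    Σ (Col k) λ K → Rich r K × K ≼[ _≤P_ ] col n χ
lemma3p6 k _≤P_ ≤P-po (suc q) (s≤s z≤n) n χ s (_ , maximal) A B A-hom B-hom ∣A∣+4q≡s A<B 2r≤∣A∣ 6r≤∣B∣
  with homogeneous⇒monochromatic χ A-hom (≤-trans (m≤m*n 2 (suc q)) 2r≤∣A∣)
     | homogeneous⇒monochromatic χ B-hom (≤-trans (≤-trans (s≤s (s≤s z≤n)) (m≤m*n 6 (suc q))) 6r≤∣B∣)
... | α , A-α | β , B-β
  with rich⊎large-homogeneous χ {_≤P_} (IsPartialOrder.refl ≤P-po) A<B A-α B-β
         (≤-trans (m≤m+n (suc q) _) 2r≤∣A∣) (≤-trans (m≤m+n (suc q) _) 6r≤∣B∣)
... | inj₁ rich = rich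
... | inj₂ (U , U-hom , ∣A∣+∣B∣≤2q+∣U∣) =
  contradiction 6r≤∣B∣ (<⇒≱ (cardinality-bound q ∣A∣+∣B∣≤2q+∣U∣ ∣U∣≤s))
  where
  ∣U∣≤s : ∣ U ∣ ≤ ∣ A ∣ + (4 * suc q ∸ 4)
  ∣U∣≤s = subst (∣ U ∣ ≤_) (sym ∣A∣+4q≡s) (maximal U U-hom)
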